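{- For any graphs $G$ and $H$ of orders $n\ge 2$ and $n'\ge 2$, respectively, $$\gamma_{\rm sp}(G\Box H)\le\min\{n'\gamma_{\rm sp}(G),\,n\gamma_{\rm sp}(H)\}.$$
   Context: All graphs are finite, simple and undirected. For a vertex $v$, $N(v)$ is its set of neighbours; for $D\subseteq V(G)$, $\overline{D}=V(G)\setminus D$. A set $D\subseteq V(G)$ is a super dominating set of $G$ if for every $u\in\overline{D}$ there exists $v\in D$ such that $N(v)\cap\overline{D}=\{u\}$; the super domination number $\gamma_{\rm sp}(G)$ is the minimum cardinality of a super dominating set of $G$. The Cartesian product $G\Box H$ has vertex set $V(G)\times V(H)$, with $(g,h)$ adjacent to $(g',h')$ iff either $g=g'$ and $hh'\in E(H)$, or $gg'\in E(G)$ and $h=h'$. -}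

module Defs where

open import Data.Nat using (ℕ; _*_; _≤_)
open import Data.Fin using (Fin; remQuot)
open import Data.Fin.Subset using (Subset; _∈_; _∉_; ∣_∣)
open import Data.Product using (Σ; ∃; _×_; _,_; proj₁; proj₂)
open import Data.Sum using (_⊎_)
open import Relation.Binary.PropositionalEquality using (_≡_)
open import Relation.Nullary using (¬_)

record Graph (n : ℕ) : Set₁ where
  field
    Adj     : Fin n → Fin n → Set
    sym     : ∀ {u v} → Adj u v → Adj v u
    irrefl  : ∀ {v} → ¬ Adj v v
open Graph public

-- Cartesian product G □ H on vertex set Fin (n * m); vertex i corresponds to
-- the pair remQuot m i = (g , h).
_□_ : ∀ {n m} → Graph n → Graph m → Graph (n * m)
_□_ {n} {m} G H = record
  { Adj    = λ i j → ProdAdj (remQuot m i) (remQuot m j)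
  ; sym    = λ { {i} {j} p → symP (remQuot m i) (remQuot m j) p }
  ; irrefl = λ { {i} p → irrP (remQuot m i) p }
  }
  where
  ProdAdj : Fin n × Fin m → Fin n × Fin m → Set
  ProdAdj (g , h) (g' , h') = (g ≡ g' × Adj H h h') ⊎ (Adj G g g' × h ≡ h')
  symP : ∀ x y → ProdAdj x y → ProdAdj y x
  symP (g , h) (g' , h') (Data.Sum.inj₁ (Relation.Binary.PropositionalEquality.refl , a)) =
    Data.Sum.inj₁ (Relation.Binary.PropositionalEquality.refl , Graph.sym H a)
  symP (g , h) (g' , h') (Data.Sum.inj₂ (a , Relation.Binary.PropositionalEquality.refl)) =
    Data.Sum.inj₂ (Graph.sym G a , Relation.Binary.PropositionalEquality.refl)
  irrP : ∀ x → ¬ ProdAdj x x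
  irrP (g , h) (Data.Sum.inj₁ (_ , a)) = Graph.irrefl H a
  irrP (g , h) (Data.Sum.inj₂ (a , _)) = Graph.irrefl G a

IsSuperDominating : ∀ {n} → Graph n → Subset n → Set
IsSuperDominating {n} G D =
  ∀ u → u ∉ D → Σ (Fin n) λ v → v ∈ D × Adj G v u ×
    (∀ w → w ∉ D → Adj G v w → w ≡ u)

SuperDomNumber : ∀ {n} → Graph n → ℕ → Set
SuperDomNumber {n} G k =
  (Σ (Subset n) λ D → IsSuperDominating G D × ∣ D ∣ ≡ k) ×
  (∀ D → IsSuperDominating G D → k ≤ ∣ D ∣)

-- If D is super dominating in G, then so is D × V(H) in G □ H: a vertex (g , h) outside
-- it is the unique outside neighbour of (g' , h), where g' ∈ D witnesses g ∉ D. Indeed a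
-- neighbour of (g' , h) either lies in the layer {g'} × V(H) ⊆ D × V(H), or is (g'' , h)
-- with g'' ∉ D adjacent to g', which forces g'' = g. Symmetrically V(G) × E works for a
-- super dominating set E of H, and the two lifts have n' γ_sp(G) and n γ_sp(H) vertices.
module Submission where

open import Defs hiding (sym)
open import Data.Bool using (_∧_)
open import Data.Empty using (⊥-elim)
open import Data.Fin using (Fin; combine; quotient; remainder)
open import Data.Fin.Properties using (remQuot-combine; combine-remQuot)
open import Data.Fin.Subset using (Subset; _∈_; _∉_; ∣_∣; ⊤; ⊥; inside; outside)
open import Data.Fin.Subset.Properties using (∈⊤; ∣⊤∣≡n; ∣⊥∣≡0)
open import Data.Nat using (ℕ; suc; _+_; _*_; _≤_; _⊓_)
open import Data.Nat.Properties using (*-comm; ⊓-glb; module ≤-Reasoning)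
open import Data.Product using (_×_; _,_)
open import Data.Sum using (_⊎_; inj₁; inj₂)
open import Data.Vec using ([]; _∷_; _++_; map; concat; lookup)
open import Data.Vec.Properties
  using (lookup-concat; lookup-map; map-id; map-const; []=⇒lookup; lookup⇒[]=)
open import Function using (id)
open import Function.Bundles using (_⇔_; mk⇔; Equivalence)
open import Relation.Binary.PropositionalEquality
  using (_≡_; refl; sym; cong; cong₂; subst; subst₂; module ≡-Reasoning)

private
  variable
    k m n : ℕ

∣p++q∣≡∣p∣+∣q∣ : (p : Subset m) (q : Subset k) → ∣ p ++ q ∣ ≡ ∣ p ∣ + ∣ q ∣
∣p++q∣≡∣p∣+∣q∣ []            q = refl
∣p++q∣≡∣p∣+∣q∣ (inside  ∷ p) q = cong suc (∣p++q∣≡∣p∣+∣q∣ p q)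
∣p++q∣≡∣p∣+∣q∣ (outside ∷ p) q = ∣p++q∣≡∣p∣+∣q∣ p q

_⊠_ : Subset m → Subset n → Subset (m * n)
p ⊠ q = concat (map (λ x → map (x ∧_) q) p)

∣p⊠q∣≡∣p∣*∣q∣ : (p : Subset m) (q : Subset n) → ∣ p ⊠ q ∣ ≡ ∣ p ∣ * ∣ q ∣
∣p⊠q∣≡∣p∣*∣q∣ []            q = refl
∣p⊠q∣≡∣p∣*∣q∣ (inside  ∷ p) q = begin
  ∣ map id q ++ p ⊠ q ∣        ≡⟨ ∣p++q∣≡∣p∣+∣q∣ (map id q) (p ⊠ q) ⟩
  ∣ map id q ∣ + ∣ p ⊠ q ∣     ≡⟨ cong₂ _+_ (cong ∣_∣ (map-id q)) (∣p⊠q∣≡∣p∣*∣q∣ p q) ⟩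
  ∣ q ∣ + ∣ p ∣ * ∣ q ∣        ∎
  where open ≡-Reasoning
∣p⊠q∣≡∣p∣*∣q∣ {n = n} (outside ∷ p) q = begin
  ∣ map (λ _ → outside) q ++ p ⊠ q ∣
    ≡⟨ ∣p++q∣≡∣p∣+∣q∣ (map (λ _ → outside) q) (p ⊠ q) ⟩
  ∣ map (λ _ → outside) q ∣ + ∣ p ⊠ q ∣
    ≡⟨ cong₂ _+_ (cong ∣_∣ (map-const q outside)) (∣p⊠q∣≡∣p∣*∣q∣ p q) ⟩
  ∣ ⊥ {n = n} ∣ + ∣ p ∣ * ∣ q ∣
    ≡⟨ cong (_+ ∣ p ∣ * ∣ q ∣) (∣⊥∣≡0 n) ⟩
  ∣ p ∣ * ∣ q ∣
    ∎
  where open ≡-Reasoning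

lookup-⊠ : (p : Subset m) (q : Subset n) (g : Fin m) (h : Fin n) →
           lookup (p ⊠ q) (combine g h) ≡ lookup p g ∧ lookup q h
lookup-⊠ p q g h = begin
  lookup (p ⊠ q) (combine g h)      ≡⟨ lookup-concat rows g h ⟩
  lookup (lookup rows g) h          ≡⟨ cong (λ row → lookup row h) (lookup-map g _ p) ⟩
  lookup (map (lookup p g ∧_) q) h  ≡⟨ lookup-map h _ q ⟩
  lookup p g ∧ lookup q h           ∎
  where
  open ≡-Reasoning
  rows = map (λ x → map (x ∧_) q) p

∈⊠⁺ : {p : Subset m} {q : Subset n} {g : Fin m} {h : Fin n} →
      g ∈ p → h ∈ q → combine g h ∈ p ⊠ q
∈⊠⁺ {p = p} {q} {g} {h} g∈p h∈q = lookup⇒[]= (combine g h) (p ⊠ q) (begin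
  lookup (p ⊠ q) (combine g h) ≡⟨ lookup-⊠ p q g h ⟩
  lookup p g ∧ lookup q h      ≡⟨ cong₂ _∧_ ([]=⇒lookup g∈p) ([]=⇒lookup h∈q) ⟩
  inside                       ∎)
  where open ≡-Reasoning

data CombineView {m n : ℕ} : Fin (m * n) → Set where
  combined : (g : Fin m) (h : Fin n) → CombineView (combine g h)

combineView : ∀ m n (i : Fin (m * n)) → CombineView {m} {n} i
combineView m n i =
  subst CombineView (combine-remQuot {m} n i) (combined (quotient {m} n i) (remainder {m} n i))

module _ (G : Graph m) (H : Graph n) where

  □-adj : {g g' : Fin m} {h h' : Fin n} →
          Adj (G □ H) (combine g h) (combine g' h') ⇔
          ((g ≡ g' × Adj H h h') ⊎ (Adj G g g' × h ≡ h'))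
  □-adj {g} {g'} {h} {h'} =
    mk⇔ (subst₂ PairAdj split split') (subst₂ PairAdj (sym split) (sym split'))
    where
    PairAdj : Fin m × Fin n → Fin m × Fin n → Set
    PairAdj (g , h) (g' , h') = (g ≡ g' × Adj H h h') ⊎ (Adj G g g' × h ≡ h')
    split  = remQuot-combine {k = n} g h
    split' = remQuot-combine {k = n} g' h'

  ⊠⊤-superDominating : {D : Subset m} →
                       IsSuperDominating G D → IsSuperDominating (G □ H) (D ⊠ ⊤ {n})
  ⊠⊤-superDominating {D} D-sd u u∉ with combineView m n u
  ... | combined g h with D-sd g (λ g∈D → u∉ (∈⊠⁺ g∈D ∈⊤))
  ... | g' , g'∈D , g'~g , unique =
    combine g' h , ∈⊠⁺ g'∈D ∈⊤ , Equivalence.from □-adj (inj₂ (g'~g , refl)) , only-u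
    where
    only-u : ∀ w → w ∉ D ⊠ ⊤ {n} → Adj (G □ H) (combine g' h) w → w ≡ combine g h
    only-u w w∉ v~w with combineView m n w
    ... | combined g'' h'' with Equivalence.to □-adj v~w
    ... | inj₁ (refl , _)      = ⊥-elim (w∉ (∈⊠⁺ g'∈D ∈⊤))
    ... | inj₂ (g'~g'' , refl) =
      cong (λ x → combine x h) (unique g'' (λ g''∈D → w∉ (∈⊠⁺ g''∈D ∈⊤)) g'~g'')

  ⊤⊠-superDominating : {E : Subset n} →
                       IsSuperDominating H E → IsSuperDominating (G □ H) (⊤ {m} ⊠ E)
  ⊤⊠-superDominating {E} E-sd u u∉ with combineView m n u
  ... | combined g h with E-sd h (λ h∈E → u∉ (∈⊠⁺ (∈⊤ {x = g}) h∈E))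
  ... | h' , h'∈E , h'~h , unique =
    combine g h' , ∈⊠⁺ (∈⊤ {x = g}) h'∈E , Equivalence.from □-adj (inj₁ (refl , h'~h)) , only-u
    where
    only-u : ∀ w → w ∉ ⊤ {m} ⊠ E → Adj (G □ H) (combine g h') w → w ≡ combine g h
    only-u w w∉ v~w with combineView m n w
    ... | combined g'' h'' with Equivalence.to □-adj v~w
    ... | inj₂ (_ , refl)      = ⊥-elim (w∉ (∈⊠⁺ (∈⊤ {x = g''}) h'∈E))
    ... | inj₁ (refl , h'~h'') =
      cong (combine g) (unique h'' (λ h''∈E → w∉ (∈⊠⁺ (∈⊤ {x = g''}) h''∈E)) h'~h'')

corollary21 : ∀ {n n'} → 2 ≤ n → 2 ≤ n' → (G : Graph n) → (H : Graph n') →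
    ∀ k k' m → SuperDomNumber G k → SuperDomNumber H k' → SuperDomNumber (G □ H) m →
    m ≤ (n' * k) ⊓ (n * k')
corollary21 {n} {n'} _ _ G H k k' m ((D , D-sd , ∣D∣≡k) , _) ((E , E-sd , ∣E∣≡k') , _)
            (_ , minimal) =
  ⊓-glb
    (begin
      m                   ≤⟨ minimal (D ⊠ ⊤) (⊠⊤-superDominating G H D-sd) ⟩
      ∣ D ⊠ ⊤ {n'} ∣      ≡⟨ ∣p⊠q∣≡∣p∣*∣q∣ D ⊤ ⟩
      ∣ D ∣ * ∣ ⊤ {n'} ∣  ≡⟨ cong₂ _*_ ∣D∣≡k (∣⊤∣≡n n') ⟩
      k * n'              ≡⟨ *-comm k n' ⟩
      n' * k              ∎)
    (begin
      m                   ≤⟨ minimal (⊤ {n} ⊠ E) (⊤⊠-superDominating G H E-sd) ⟩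
      ∣ ⊤ {n} ⊠ E ∣       ≡⟨ ∣p⊠q∣≡∣p∣*∣q∣ (⊤ {n}) E ⟩
      ∣ ⊤ {n} ∣ * ∣ E ∣   ≡⟨ cong₂ _*_ (∣⊤∣≡n n) ∣E∣≡k' ⟩
      n * k'              ∎)
  where open ≤-Reasoning
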